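{- Let $\Sigma$ be an alphabet, $A,B\subseteq\Sigma^*$ and $k\in\mathbb{N}$. Then S has a winning strategy in the game $\mathrm{RES}(k,A,B)$ if and only if there is a regular expression of size at most $k$ that separates $A$ from $B$.
   Context: Regular expressions (RE) over $\Sigma$: $\emptyset$, $\epsilon$ and each $a\in\Sigma$ are RE; if $R_1,R_2$ are RE then so are $R_1\cup R_2$, $R_1R_2$, $R_1^*$, with the usual languages $L(R)$. Size: $\mathrm{sz}(\emptyset)=\mathrm{sz}(\epsilon)=\mathrm{sz}(a)=1$, $\mathrm{sz}(R^*)=\mathrm{sz}(R)+1$, $\mathrm{sz}(R_1\cup R_2)=\mathrm{sz}(R_1R_2)=\mathrm{sz}(R_1)+\mathrm{sz}(R_2)+1$. $R$ separates $A$ from $B$ if $A\subseteq L(R)$ and $B\subseteq\Sigma^*\setminus L(R)$. For a word $w$, $\mathrm{Sp}^n(w)=\{(w_1,\dots,w_n)\mid w_1\cdots w_n=w\}$, $\mathrm{Sp}(w)=\bigcup_n\mathrm{Sp}^n(w)$, $[n]=\{1,\dots,n\}$. The game $\mathrm{RES}(k_0,A_0,B_0)$ between S and D has positions $(k,A,B)$, starting at $(k_0,A_0,B_0)$. At $(k,A,B)$: if $k=0$, D wins. Otherwise S chooses one move: (a-move) S chooses $a\in\Sigma\cup\{\epsilon\}$; S wins if $A\subseteq\{a\}$ and $a\notin B$, else D wins. ($\emptyset$-move) S wins if $A=\emptyset$, else D wins. ($\cup$-move) S chooses $A_1,A_2\subseteq A$ with $A_1\cup A_2=A$ and $k_1,k_2$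 with $k_1+k_2+1=k$; D chooses $i\in\{1,2\}$; continue from $(k_i,A_i,B)$. (cat-move) For each $w\in A$ S chooses $(w_1,w_2)\in\mathrm{Sp}^2(w)$, $A_i=\{w_i\mid w\in A\}$; for each $v\in B$ S chooses $f_v:\mathrm{Sp}^2(v)\to\{1,2\}$, $B_i=\{v_i\mid v\in B,(v_1,v_2)\in\mathrm{Sp}^2(v),f_v(v_1,v_2)=i\}$; S chooses $k_1+k_2+1=k$; D chooses $i$; continue from $(k_i,A_i,B_i)$. ($*$-move) If $\epsilon\in B$, D wins. Otherwise for each $w\in A\setminus\{\epsilon\}$ S chooses a split of $w$ into $n(w)>0$ nonempty pieces, $A'$ = set of all pieces; for each $v\in B$ S chooses $f_v$ assigning to each $(v_1,\dots,v_n)\in\mathrm{Sp}(v)$ an index in $[n]$, $B'$ = set of chosen pieces $v_{f_v(v_1,\dots,v_n)}$; continue from $(k-1,A',B')$. -}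

module Defs where

open import Level using (0ℓ)
open import Data.Nat using (ℕ; zero; suc; _+_; _<_)
open import Data.Fin using (Fin; zero; suc)
open import Data.List using (List; []; _∷_; _++_; [_]; concat; length; lookup)
open import Data.List.Relation.Unary.All using (All)
open import Data.List.Membership.Propositional using (_∈_)
open import Data.Maybe using (Maybe; just; nothing)
open import Data.Product using (Σ; ∃; _×_; _,_; proj₁; proj₂)
open import Relation.Unary using (Pred; _⊆_; _∪_)
open import Relation.Binary.PropositionalEquality using (_≡_; _≢_)
open import Relation.Nullary using (¬_)

Lang : Set → Set₁
Lang Sym = Pred (List Sym) 0ℓ

infixl 6 _∪ᵣ_
infixl 7 _·ᵣ_
infix 8 _*ᵣ

data RE (Sym : Set) : Set where
  ∅ᵣ εᵣ : RE Sym
  chr   : Sym → RE Sym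
  _∪ᵣ_  : RE Sym → RE Sym → RE Sym
  _·ᵣ_  : RE Sym → RE Sym → RE Sym
  _*ᵣ   : RE Sym → RE Sym

size : ∀ {Sym : Set} → RE Sym → ℕ
size ∅ᵣ = 1
size εᵣ = 1
size (chr a) = 1
size (R *ᵣ) = size R + 1
size (R₁ ∪ᵣ R₂) = size R₁ + size R₂ + 1
size (R₁ ·ᵣ R₂) = size R₁ + size R₂ + 1

data L {Sym : Set} : RE Sym → List Sym → Set where
  ε∈     : L εᵣ []
  chr∈   : ∀ a → L (chr a) [ a ]
  inl∈   : ∀ {R₁ R₂ w} → L R₁ w → L (R₁ ∪ᵣ R₂) w
  inr∈   : ∀ {R₁ R₂ w} → L R₂ w → L (R₁ ∪ᵣ R₂) w
  cat∈   : ∀ {R₁ R₂ u v} → L R₁ u → L R₂ v → L (R₁ ·ᵣ R₂) (u ++ v)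
  nil∈   : ∀ {R} → L (R *ᵣ) []
  cons∈  : ∀ {R u v} → L R u → L (R *ᵣ) v → L (R *ᵣ) (u ++ v)

Separates : ∀ {Sym : Set} → RE Sym → Lang Sym → Lang Sym → Set
Separates R A B = (∀ {w} → A w → L R w) × (∀ v → B v → ¬ L R v)

word : ∀ {Sym : Set} → Maybe Sym → List Sym
word nothing = []
word (just a) = [ a ]

Sp2 : ∀ {Sym : Set} → List Sym → Set
Sp2 {Sym} w = Σ (List Sym × List Sym) λ p → proj₁ p ++ proj₂ p ≡ w

Sp : ∀ {Sym : Set} → List Sym → Set
Sp {Sym} w = Σ (List (List Sym)) λ ps → concat ps ≡ w

NESplit : ∀ {Sym : Set} → List Sym → Set
NESplit {Sym} w = Σ (List (List Sym)) λ ps →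
  (concat ps ≡ w) × All (λ p → p ≢ []) ps × (0 < length ps)

piece : ∀ {Sym : Set} {w : List Sym} → Fin 2 → Sp2 w → List Sym
piece zero       ((w₁ , w₂) , _) = w₁
piece (suc zero) ((w₁ , w₂) , _) = w₂

CatA : ∀ {Sym : Set} (A : Lang Sym) → ((w : List Sym) → A w → Sp2 w) → Fin 2 → Lang Sym
CatA A s i u = ∃ λ w → Σ (A w) λ p → piece i (s w p) ≡ u

CatB : ∀ {Sym : Set} (B : Lang Sym) → ((v : List Sym) → B v → Sp2 v → Fin 2) → Fin 2 → Lang Sym
CatB B f i u = ∃ λ v → Σ (B v) λ b → Σ (Sp2 v) λ sp → (f v b sp ≡ i) × (piece i sp ≡ u)

StarA : ∀ {Sym : Set} (A : Lang Sym) → ((w : List Sym) → A w → w ≢ [] → NESplit w) → Lang Sym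
StarA A s u = ∃ λ w → Σ (A w) λ p → Σ (w ≢ []) λ ne → u ∈ proj₁ (s w p ne)

StarB : ∀ {Sym : Set} (B : Lang Sym) →
        ((v : List Sym) → B v → (sp : Sp v) → Fin (length (proj₁ sp))) → Lang Sym
StarB B f u = ∃ λ v → Σ (B v) λ b → Σ (Sp v) λ sp → lookup (proj₁ sp) (f v b sp) ≡ u

-- Wins k A B : player S has a winning strategy in RES(k, A, B).
-- (The game has depth ≤ k, so this inductive definition is exactly the
-- existence of a winning strategy; position k = 0 has no constructor: D wins.)
data Wins {Sym : Set} : ℕ → Lang Sym → Lang Sym → Set₁ where
  a-move : ∀ {k A B} (a : Maybe Sym) →
           A ⊆ (_≡ word a) → ¬ B (word a) → Wins (suc k) A B
  ∅-move : ∀ {k A B} → (∀ w → ¬ A w) → Wins (suc k) A B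
  ∪-move : ∀ {k A B} (A₁ A₂ : Lang Sym) (k₁ k₂ : ℕ) → k₁ + k₂ + 1 ≡ k →
           A₁ ⊆ A → A₂ ⊆ A → A ⊆ A₁ ∪ A₂ →
           Wins k₁ A₁ B → Wins k₂ A₂ B → Wins k A B
  cat-move : ∀ {k A B}
           (s : (w : List Sym) → A w → Sp2 w)
           (f : (v : List Sym) → B v → Sp2 v → Fin 2)
           (k₁ k₂ : ℕ) → k₁ + k₂ + 1 ≡ k →
           Wins k₁ (CatA A s zero) (CatB B f zero) →
           Wins k₂ (CatA A s (suc zero)) (CatB B f (suc zero)) →
           Wins k A B
  *-move : ∀ {k A B} → ¬ B [] →
           (s : (w : List Sym) → A w → w ≢ [] → NESplit w)
           (f : (v : List Sym) → B v → (sp : Sp v) → Fin (length (proj₁ sp))) →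
           Wins k (StarA A s) (StarB B f) →
           Wins (suc k) A B

-- Soundness: each move of S builds one constructor of a separating expression,
-- and the budget k is split exactly as the size function splits.
-- Completeness: S follows the syntax tree of a separator R.  For A, S splits
-- words along their membership derivations; for B, S must name, for every
-- split of a rejected word, a component rejected by the corresponding
-- subexpression.  Such a component exists since the whole word is rejected,
-- and it can be computed because membership in L(R) is decidable.  Extra
-- budget never hurts S, so a separator of size at most k suffices.
module Submission where

open import Defs
open import Data.Nat using (ℕ; suc; _+_; _≤_; _<_; z≤n; s≤s)
open import Data.Nat.Properties
  using (≤-refl; ≤-trans; ≤-<-trans; ≤-reflexive; +-comm; +-monoˡ-≤; +-mono-≤; m≤n⇒∃[o]m+o≡n)
open import Data.Nat.Tactic.RingSolver using (solve-∀)
open import Data.Fin using (Fin; zero; suc) renaming (_≟_ to _≟ᶠ_)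
open import Data.List using (List; []; _∷_; _++_; [_]; concat; length; lookup)
open import Data.List.Properties using (length-++-≤ʳ)
open import Data.List.Relation.Unary.All as All using (All; []; _∷_; all?)
open import Data.List.Relation.Unary.All.Properties using (¬All⇒Any¬)
open import Data.List.Relation.Unary.Any as Any using ()
open import Data.List.Relation.Unary.Any.Properties using (lookup-index)
open import Data.List.Membership.Propositional.Properties using (∈-lookup)
open import Data.Maybe using (just; nothing)
open import Data.Product using (Σ; ∃; ∃₂; _×_; _,_; proj₁; proj₂)
open import Data.Sum using (inj₁; inj₂)
open import Data.Empty using (⊥-elim)
open import Function.Base using (_∘_)
open import Function.Bundles using (_⇔_; mk⇔)
open import Relation.Binary.Definitions using (DecidableEquality)
open import Relation.Binary.PropositionalEquality using (_≡_; _≢_; refl; sym; cong; subst)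
open import Relation.Nullary using (¬_; Dec; yes; no)
open import Relation.Nullary.Decidable using (map′; _×-dec_)
open import Relation.Unary using (Decidable; _⊆_; _∩_; _∪_)

private
  variable
    Sym : Set
    R R₁ R₂ : RE Sym
    w : List Sym

∉∅ : ¬ L ∅ᵣ w
∉∅ ()

Lε⇒≡[] : L εᵣ w → w ≡ []
Lε⇒≡[] ε∈ = refl

Lchr⇒≡[a] : ∀ {a} → L (chr a) w → w ≡ [ a ]
Lchr⇒≡[a] (chr∈ _) = refl

L·⇒split : L (R₁ ·ᵣ R₂) w → Σ (Sp2 w) λ sp → L R₁ (piece zero sp) × L R₂ (piece (suc zero) sp)
L·⇒split (cat∈ {u = u} {v = v} u∈ v∈) = ((u , v) , refl) , u∈ , v∈

All⇒L* : ∀ {ps} → All (L R) ps → L (R *ᵣ) (concat ps)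
All⇒L* [] = nil∈
All⇒L* (p∈ ∷ ps∈) = cons∈ p∈ (All⇒L* ps∈)

Factorisation : RE Sym → List Sym → Set
Factorisation {Sym} R w =
  Σ (List (List Sym)) λ ps → (concat ps ≡ w) × All (_≢ []) ps × All (L R) ps

L*⇒factorisation : L (R *ᵣ) w → Factorisation R w
L*⇒factorisation nil∈ = [] , refl , [] , []
L*⇒factorisation (cons∈ {u = []} _ v∈) = L*⇒factorisation v∈
L*⇒factorisation (cons∈ {u = x ∷ u} u∈ v∈) with L*⇒factorisation v∈
... | ps , refl , ps≢[] , ps∈ = (x ∷ u) ∷ ps , refl , (λ ()) ∷ ps≢[] , u∈ ∷ ps∈

L*-uncons : ∀ {x w′} → L (R *ᵣ) w → w ≡ x ∷ w′ →
            ∃₂ λ u v → (u ++ v ≡ w′) × L R (x ∷ u) × L (R *ᵣ) v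
L*-uncons (cons∈ {u = []} _ v∈) eq = L*-uncons v∈ eq
L*-uncons (cons∈ {u = _ ∷ u} {v = v} u∈ v∈) refl = u , v , refl , u∈ , v∈

split? : (w : List Sym) {P : List Sym → List Sym → Set} →
         (∀ u v → u ++ v ≡ w → Dec (P u v)) →
         Dec (∃₂ λ u v → (u ++ v ≡ w) × P u v)
split? [] P? with P? [] [] refl
... | yes p = yes ([] , [] , refl , p)
... | no ¬p = no λ { ([] , [] , refl , p) → ¬p p }
split? (x ∷ w) {P} P? with P? [] (x ∷ w) refl
... | yes p = yes ([] , x ∷ w , refl , p)
... | no ¬p with split? w {λ u → P (x ∷ u)} (λ u v eq → P? (x ∷ u) v (cong (x ∷_) eq))
...   | yes (u , v , eq , p) = yes (x ∷ u , v , cong (x ∷_) eq , p)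
...   | no ¬q = no λ where
  ([] , _ , refl , p) → ¬p p
  (_ ∷ u , v , refl , p) → ¬q (u , v , refl , p)

-- The fuel n bounds the length of the word, and it shrinks because the
-- first factor of a star is taken nonempty.
L*?-bounded : Decidable (L R) → ∀ n w → length w < n → Dec (L (R *ᵣ) w)
L*?-bounded R? (suc n) [] _ = yes nil∈
L*?-bounded {R = R} R? (suc n) (x ∷ w) (s≤s |w|≤n) =
  map′ (λ (u , v , eq , u∈ , v∈) → subst (L (R *ᵣ)) (cong (x ∷_) eq) (cons∈ u∈ v∈))
       (λ w∈ → L*-uncons w∈ refl)
       (split? w {λ u v → L R (x ∷ u) × L (R *ᵣ) v}
               λ u v eq → R? (x ∷ u) ×-dec L*?-bounded R? n v (shorter u v eq))
  where
  shorter : ∀ u v → u ++ v ≡ w → length v < n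
  shorter u v refl = ≤-<-trans (length-++-≤ʳ v {u}) |w|≤n

module _ (_≟_ : DecidableEquality Sym) where

  L? : (R : RE Sym) → Decidable (L R)
  L? ∅ᵣ w = no λ ()
  L? εᵣ [] = yes ε∈
  L? εᵣ (_ ∷ _) = no λ ()
  L? (chr a) [] = no λ ()
  L? (chr a) (x ∷ []) with x ≟ a
  ... | yes refl = yes (chr∈ x)
  ... | no x≢a = no λ { (chr∈ _) → x≢a refl }
  L? (chr a) (_ ∷ _ ∷ _) = no λ ()
  L? (R₁ ∪ᵣ R₂) w with L? R₁ w | L? R₂ w
  ... | yes w∈₁ | _ = yes (inl∈ w∈₁)
  ... | no _ | yes w∈₂ = yes (inr∈ w∈₂)
  ... | no w∉₁ | no w∉₂ = no λ { (inl∈ w∈₁) → w∉₁ w∈₁ ; (inr∈ w∈₂) → w∉₂ w∈₂ }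
  L? (R₁ ·ᵣ R₂) w =
    map′ (λ (u , v , eq , u∈ , v∈) → subst (L (R₁ ·ᵣ R₂)) eq (cat∈ u∈ v∈))
         (λ w∈ → let ((u , v) , eq) , u∈ , v∈ = L·⇒split w∈ in u , v , eq , u∈ , v∈)
         (split? w {λ u v → L R₁ u × L R₂ v} λ u v _ → L? R₁ u ×-dec L? R₂ v)
  L? (R *ᵣ) w = L*?-bounded (L? R) (suc (length w)) w ≤-refl

Separator : ℕ → Lang Sym → Lang Sym → Set
Separator {Sym} k A B = ∃ λ (R : RE Sym) → (size R ≤ k) × Separates R A B

Wins⇒Separator : ∀ {k} {A B : Lang Sym} → Wins k A B → Separator k A B
Wins⇒Separator (a-move nothing A⊆ε ε∉B) =
  εᵣ , s≤s z≤n , (λ w∈A → subst (L εᵣ) (sym (A⊆ε w∈A)) ε∈) , λ { _ v∈B ε∈ → ε∉B v∈B }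
Wins⇒Separator (a-move (just a) A⊆a a∉B) =
  chr a , s≤s z≤n , (λ w∈A → subst (L (chr a)) (sym (A⊆a w∈A)) (chr∈ a)) ,
  λ { _ v∈B (chr∈ _) → a∉B v∈B }
Wins⇒Separator (∅-move A-empty) =
  ∅ᵣ , s≤s z≤n , (λ {w} w∈A → ⊥-elim (A-empty w w∈A)) , λ _ _ ()
Wins⇒Separator {A = A} {B} (∪-move A₁ A₂ k₁ k₂ refl _ _ A⊆A₁∪A₂ win₁ win₂)
  with Wins⇒Separator win₁ | Wins⇒Separator win₂
... | R₁ , size₁ , A₁⊆ , B∩₁ | R₂ , size₂ , A₂⊆ , B∩₂ =
  R₁ ∪ᵣ R₂ , +-monoˡ-≤ 1 (+-mono-≤ size₁ size₂) , accept , reject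
  where
  accept : ∀ {w} → A w → L (R₁ ∪ᵣ R₂) w
  accept w∈A with A⊆A₁∪A₂ w∈A
  ... | inj₁ w∈A₁ = inl∈ (A₁⊆ w∈A₁)
  ... | inj₂ w∈A₂ = inr∈ (A₂⊆ w∈A₂)
  reject : ∀ v → B v → ¬ L (R₁ ∪ᵣ R₂) v
  reject v v∈B (inl∈ v∈₁) = B∩₁ v v∈B v∈₁
  reject v v∈B (inr∈ v∈₂) = B∩₂ v v∈B v∈₂
Wins⇒Separator {A = A} {B} (cat-move s f k₁ k₂ refl win₁ win₂)
  with Wins⇒Separator win₁ | Wins⇒Separator win₂
... | R₁ , size₁ , A₁⊆ , B∩₁ | R₂ , size₂ , A₂⊆ , B∩₂ =
  R₁ ·ᵣ R₂ , +-monoˡ-≤ 1 (+-mono-≤ size₁ size₂) , accept , reject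
  where
  accept : ∀ {w} → A w → L (R₁ ·ᵣ R₂) w
  accept {w} w∈A = subst (L (R₁ ·ᵣ R₂)) (proj₂ (s w w∈A))
    (cat∈ (A₁⊆ (w , w∈A , refl)) (A₂⊆ (w , w∈A , refl)))
  reject : ∀ v → B v → ¬ L (R₁ ·ᵣ R₂) v
  reject _ v∈B (cat∈ {u = u} {v = v} u∈ v∈) with f (u ++ v) v∈B ((u , v) , refl) in chosen
  ... | zero = B∩₁ u (u ++ v , v∈B , ((u , v) , refl) , chosen , refl) u∈
  ... | suc zero = B∩₂ v (u ++ v , v∈B , ((u , v) , refl) , chosen , refl) v∈
Wins⇒Separator {A = A} {B} (*-move {k = k} _ s f win) with Wins⇒Separator win
... | R , size≤k , A′⊆ , B′∩ =
  R *ᵣ , ≤-trans (+-monoˡ-≤ 1 size≤k) (≤-reflexive (+-comm k 1)) , accept , reject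
  where
  accept : ∀ {w} → A w → L (R *ᵣ) w
  accept {[]} _ = nil∈
  accept {w@(_ ∷ _)} w∈A = subst (L (R *ᵣ)) (proj₁ (proj₂ split)) (All⇒L* pieces∈)
    where
    w≢[] : w ≢ []
    w≢[] ()
    split : NESplit w
    split = s w w∈A w≢[]
    pieces∈ : All (L R) (proj₁ split)
    pieces∈ = All.tabulate λ p∈ → A′⊆ (w , w∈A , w≢[] , p∈)
  reject : ∀ v → B v → ¬ L (R *ᵣ) v
  reject v v∈B v∈ with L*⇒factorisation v∈
  ... | ps , eq , _ , ps∈ =
    B′∩ _ (v , v∈B , (ps , eq) , refl) (All.lookup ps∈ (∈-lookup (f v v∈B (ps , eq))))

budget-pad : ∀ k₁ k₂ d → k₁ + (k₂ + d) + 1 ≡ k₁ + k₂ + 1 + d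
budget-pad = solve-∀

Wins-pad : ∀ {k} {A B : Lang Sym} d → Wins k A B → Wins (k + d) A B
Wins-pad d (a-move a A⊆a a∉B) = a-move a A⊆a a∉B
Wins-pad d (∅-move A-empty) = ∅-move A-empty
Wins-pad d (∪-move A₁ A₂ k₁ k₂ refl A₁⊆A A₂⊆A A⊆A₁∪A₂ win₁ win₂) =
  ∪-move A₁ A₂ k₁ (k₂ + d) (budget-pad k₁ k₂ d) A₁⊆A A₂⊆A A⊆A₁∪A₂ win₁ (Wins-pad d win₂)
Wins-pad d (cat-move s f k₁ k₂ refl win₁ win₂) =
  cat-move s f k₁ (k₂ + d) (budget-pad k₁ k₂ d) win₁ (Wins-pad d win₂)
Wins-pad d (*-move ε∉B s f win) = *-move ε∉B s f (Wins-pad d win)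

Wins-mono : ∀ {k k′} {A B : Lang Sym} → k ≤ k′ → Wins k A B → Wins k′ A B
Wins-mono k≤k′ win with m≤n⇒∃[o]m+o≡n k≤k′
... | d , refl = Wins-pad d win

operand : RE Sym → RE Sym → Fin 2 → RE Sym
operand R₁ R₂ zero = R₁
operand R₁ R₂ (suc zero) = R₂

module _ (_≟_ : DecidableEquality Sym) where

  rejected-operand : ∀ {R₁ R₂ : RE Sym} {v} → ¬ L (R₁ ·ᵣ R₂) v → (sp : Sp2 v) →
                     Σ (Fin 2) λ i → ¬ L (operand R₁ R₂ i) (piece i sp)
  rejected-operand {R₁ = R₁} {R₂} v∉ ((v₁ , v₂) , refl) with L? _≟_ R₁ v₁ | L? _≟_ R₂ v₂
  ... | no v₁∉ | _ = zero , v₁∉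
  ... | yes _ | no v₂∉ = suc zero , v₂∉
  ... | yes v₁∈ | yes v₂∈ = ⊥-elim (v∉ (cat∈ v₁∈ v₂∈))

  rejected-piece : ∀ {R : RE Sym} {v} → ¬ L (R *ᵣ) v → (sp : Sp v) →
                   Σ (Fin (length (proj₁ sp))) λ i → ¬ L R (lookup (proj₁ sp) i)
  rejected-piece {R = R} v∉ (ps , refl) with all? (L? _≟_ R) ps
  ... | yes ps∈ = ⊥-elim (v∉ (All⇒L* ps∈))
  ... | no ¬ps∈ = let some∉ = ¬All⇒Any¬ (L? _≟_ R) ps ¬ps∈ in Any.index some∉ , lookup-index some∉

  Separates⇒Wins : (R : RE Sym) {A B : Lang Sym} → Separates R A B → Wins (size R) A B
  Separates⇒Wins ∅ᵣ (A⊆ , _) = ∅-move λ _ w∈A → ∉∅ (A⊆ w∈A)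
  Separates⇒Wins εᵣ (A⊆ , B∩) = a-move nothing (Lε⇒≡[] ∘ A⊆) (λ []∈B → B∩ [] []∈B ε∈)
  Separates⇒Wins (chr a) (A⊆ , B∩) =
    a-move (just a) (Lchr⇒≡[a] ∘ A⊆) (λ a∈B → B∩ [ a ] a∈B (chr∈ a))
  Separates⇒Wins (R₁ ∪ᵣ R₂) {A} {B} (A⊆ , B∩) =
    ∪-move (A ∩ L R₁) (A ∩ L R₂) (size R₁) (size R₂) refl proj₁ proj₁ cover
      (Separates⇒Wins R₁ (proj₂ , λ v v∈B v∈₁ → B∩ v v∈B (inl∈ v∈₁)))
      (Separates⇒Wins R₂ (proj₂ , λ v v∈B v∈₂ → B∩ v v∈B (inr∈ v∈₂)))
    where
    cover : A ⊆ (A ∩ L R₁) ∪ (A ∩ L R₂)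
    cover w∈A with A⊆ w∈A
    ... | inl∈ w∈₁ = inj₁ (w∈A , w∈₁)
    ... | inr∈ w∈₂ = inj₂ (w∈A , w∈₂)
  Separates⇒Wins (R₁ ·ᵣ R₂) {A} {B} (A⊆ , B∩) =
    cat-move split choose (size R₁) (size R₂) refl
      (Separates⇒Wins R₁ (accept₁ , reject zero))
      (Separates⇒Wins R₂ (accept₂ , reject (suc zero)))
    where
    split : (w : List Sym) → A w → Sp2 w
    split w w∈A = proj₁ (L·⇒split (A⊆ w∈A))
    rejected : (v : List Sym) → B v → (sp : Sp2 v) →
               Σ (Fin 2) λ i → ¬ L (operand R₁ R₂ i) (piece i sp)
    rejected v v∈B = rejected-operand (B∩ v v∈B)
    choose : (v : List Sym) → B v → Sp2 v → Fin 2
    choose v v∈B sp = proj₁ (rejected v v∈B sp)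
    accept₁ : CatA A split zero ⊆ L R₁
    accept₁ (_ , w∈A , refl) = proj₁ (proj₂ (L·⇒split (A⊆ w∈A)))
    accept₂ : CatA A split (suc zero) ⊆ L R₂
    accept₂ (_ , w∈A , refl) = proj₂ (proj₂ (L·⇒split (A⊆ w∈A)))
    reject : ∀ i u → CatB B choose i u → ¬ L (operand R₁ R₂ i) u
    reject _ _ (v , v∈B , sp , refl , refl) = proj₂ (rejected v v∈B sp)
  Separates⇒Wins (R *ᵣ) {A} {B} (A⊆ , B∩) =
    subst (λ k → Wins k A B) (+-comm 1 (size R))
      (*-move (λ []∈B → B∩ [] []∈B nil∈) split choose (Separates⇒Wins R (accept , reject)))
    where
    split : (w : List Sym) → A w → w ≢ [] → NESplit w
    split w w∈A w≢[] with L*⇒factorisation (A⊆ w∈A)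
    ... | [] , refl , _ = ⊥-elim (w≢[] refl)
    ... | ps@(_ ∷ _) , eq , ps≢[] , _ = ps , eq , ps≢[] , s≤s z≤n
    choose : (v : List Sym) → B v → (sp : Sp v) → Fin (length (proj₁ sp))
    choose v v∈B sp = proj₁ (rejected-piece (B∩ v v∈B) sp)
    accept : StarA A split ⊆ L R
    accept (w , w∈A , w≢[] , p∈) with L*⇒factorisation (A⊆ w∈A)
    ... | [] , refl , _ = ⊥-elim (w≢[] refl)
    ... | _ ∷ _ , _ , _ , ps∈ = All.lookup ps∈ p∈
    reject : ∀ u → StarB B choose u → ¬ L R u
    reject _ (v , v∈B , sp , refl) = proj₂ (rejected-piece (B∩ v v∈B) sp)

theorem2 : (m : ℕ) (A B : Lang (Fin m)) (k : ℕ) →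
    Wins k A B ⇔ (∃ λ (R : RE (Fin m)) → (size R ≤ k) × Separates R A B)
theorem2 m A B k = mk⇔ Wins⇒Separator λ (R , size≤k , separates) →
  Wins-mono size≤k (Separates⇒Wins _≟ᶠ_ R separates)
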